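{- Let $j,k,n$ be positive integers. If $k$ divides $n$ and the path $P_j$ divides the hypercube $Q_k$, then $P_j$ divides $Q_n$.
   Context: $Q_n$ is the $n$-dimensional hypercube: vertex set the subsets of $\{1,\ldots,n\}$, with $x,y$ adjacent iff $|x\,\Delta\, y|=1$. $P_j$ denotes the path with $j$ edges. If $H$ is isomorphic to a subgraph of $G$, $H$ divides $G$ if there exist embeddings $\theta_1,\ldots,\theta_r$ of $H$ into $G$ such that $\{E(\theta_1(H)),\ldots,E(\theta_r(H))\}$ is a partition of $E(G)$. -}

module Defs where

open import Data.Nat using (ℕ; suc)
open import Data.Fin using (Fin; inject₁) renaming (suc to fsuc)
open import Data.Fin.Subset using (Subset; _─_; _∪_; ∣_∣)
open import Data.Product using (Σ; _×_; ∃)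
open import Data.Sum using (_⊎_)
open import Relation.Binary.PropositionalEquality using (_≡_)
open import Function.Definitions using (Injective)

-- Hypercube Q n : vertices are subsets of {1..n} (Subset n = Vec Side n),
-- x ~ y iff |x Δ y| = 1.
_Δ_ : ∀ {n} → Subset n → Subset n → Subset n
x Δ y = (x ─ y) ∪ (y ─ x)

QAdj : ∀ {n} → Subset n → Subset n → Set
QAdj x y = ∣ x Δ y ∣ ≡ 1

-- The path P j has vertices 0,...,j (Fin (suc j)) and the j edges
-- {i, i+1}, indexed by i : Fin j.
-- An embedding of P j into Q n: an injective vertex map sending edges to edges.
record PathEmbedding (j n : ℕ) : Set where
  field
    vmap     : Fin (suc j) → Subset n
    injective : Injective _≡_ _≡_ vmap
    preserves : (i : Fin j) → QAdj (vmap (inject₁ i)) (vmap (fsuc i))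
open PathEmbedding public

InImage : ∀ {j n} → PathEmbedding j n → Subset n → Subset n → Set
InImage {j} θ x y =
  Σ (Fin j) λ i →
    (vmap θ (inject₁ i) ≡ x × vmap θ (fsuc i) ≡ y)
    ⊎ (vmap θ (inject₁ i) ≡ y × vmap θ (fsuc i) ≡ x)

PathDividesCube : ℕ → ℕ → Set
PathDividesCube j n =
  Σ ℕ λ r → Σ (Fin r → PathEmbedding j n) λ θ →
    ∀ (x y : Subset n) → QAdj x y →
      Σ (Fin r) λ i → InImage (θ i) x y ×
        (∀ (i' : Fin r) → InImage (θ i') x y → i' ≡ i)

module Submission where

-- Idea: Q (a + b) is the Cartesian product of Q a and Q b. Writing its vertices
-- as x ++ y, two vertices are adjacent iff they agree in one coordinate block
-- and are adjacent in the other. So if the θ i decompose E(Q a) and the φ l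
-- decompose E(Q b), then the copies  θ i (-) ++ y  (one per vertex y of Q b)
-- together with  x ++ φ l (-)  (one per vertex x of Q a) decompose E(Q (a + b)).

open import Defs
open import Data.Nat using (ℕ; zero; suc; _+_; _*_; _^_; _≤_)
open import Data.Nat.Divisibility using (_∣_; divides)
open import Data.Bool using (Bool; true; false)
open import Data.Fin using (Fin) renaming (zero to fzero; suc to fsuc)
open import Data.Fin.Properties using (+↔⊎; *↔×; 2↔Bool)
open import Data.Fin.Subset using (Subset; ∣_∣)
open import Data.Vec using ([]; _∷_; _++_; splitAt)
open import Data.Vec.Properties using (++-injective; ++-injectiveˡ; ++-injectiveʳ)
open import Data.Product using (Σ; _×_; _,_; ∃₂)
open import Data.Product.Function.NonDependent.Propositional using (_×-cong_)
open import Data.Sum using (_⊎_; inj₁; inj₂)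
open import Data.Sum.Function.Propositional using (_⊎-cong_)
open import Data.Empty using (⊥-elim)
open import Relation.Nullary using (¬_)
open import Function using (_∘_)
open import Function.Bundles using (_↔_; mk↔ₛ′; Inverse)
open import Function.Definitions using (Injective)
open import Function.Properties.Inverse using (↔-refl; ↔-trans)
open import Relation.Binary.PropositionalEquality

Δ-++ : ∀ {a b} (x x' : Subset a) (y y' : Subset b) →
  (x ++ y) Δ (x' ++ y') ≡ (x Δ x') ++ (y Δ y')
Δ-++ []      []        y y' = refl
Δ-++ (_ ∷ x) (_ ∷ x')  y y' = cong (_ ∷_) (Δ-++ x x' y y')

∣∣-++ : ∀ {a b} (u : Subset a) (v : Subset b) → ∣ u ++ v ∣ ≡ ∣ u ∣ + ∣ v ∣
∣∣-++ []          v = refl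
∣∣-++ (true ∷ u)  v = cong suc (∣∣-++ u v)
∣∣-++ (false ∷ u) v = ∣∣-++ u v

distance-++ : ∀ {a b} (x x' : Subset a) (y y' : Subset b) →
  ∣ (x ++ y) Δ (x' ++ y') ∣ ≡ ∣ x Δ x' ∣ + ∣ y Δ y' ∣
distance-++ x x' y y' = begin
  ∣ (x ++ y) Δ (x' ++ y') ∣      ≡⟨ cong ∣_∣ (Δ-++ x x' y y') ⟩
  ∣ (x Δ x') ++ (y Δ y') ∣       ≡⟨ ∣∣-++ (x Δ x') (y Δ y') ⟩
  ∣ x Δ x' ∣ + ∣ y Δ y' ∣        ∎
  where open ≡-Reasoning

distance-self : ∀ {a} (x : Subset a) → ∣ x Δ x ∣ ≡ 0
distance-self []          = refl
distance-self (true ∷ x)  = distance-self x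
distance-self (false ∷ x) = distance-self x

distance-zero : ∀ {a} (x y : Subset a) → ∣ x Δ y ∣ ≡ 0 → x ≡ y
distance-zero []          []          _ = refl
distance-zero (true ∷ x)  (true ∷ y)  d = cong (true ∷_) (distance-zero x y d)
distance-zero (false ∷ x) (false ∷ y) d = cong (false ∷_) (distance-zero x y d)
distance-zero (true ∷ x)  (false ∷ y) ()
distance-zero (false ∷ x) (true ∷ y)  ()

adjacent-irreflexive : ∀ {a} (x : Subset a) → ¬ QAdj x x
adjacent-irreflexive x adj with trans (sym (distance-self x)) adj
... | ()

adjacent-++ : ∀ {a b} (x x' : Subset a) (y y' : Subset b) →
  QAdj (x ++ y) (x' ++ y') → (QAdj x x' × y ≡ y') ⊎ (x ≡ x' × QAdj y y')
adjacent-++ x x' y y' adj =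
  split (∣ x Δ x' ∣) (∣ y Δ y' ∣) refl refl (trans (sym (distance-++ x x' y y')) adj)
  where
  split : ∀ m n → ∣ x Δ x' ∣ ≡ m → ∣ y Δ y' ∣ ≡ n → m + n ≡ 1 →
    (QAdj x x' × y ≡ y') ⊎ (x ≡ x' × QAdj y y')
  split 0 _ dx dy refl = inj₂ (distance-zero x x' dx , dy)
  split 1 0 dx dy refl = inj₁ (dx , distance-zero y y' dy)
  split 1 (suc _) _ _ ()
  split (suc (suc _)) _ _ _ ()

record CubeEmbedding (a n : ℕ) : Set where
  field
    map       : Subset a → Subset n
    injective : Injective _≡_ _≡_ map
    adjacent  : ∀ {x x'} → QAdj x x' → QAdj (map x) (map x')
open CubeEmbedding

fixRight : ∀ {a b} → Subset b → CubeEmbedding a (a + b)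
fixRight y = record
  { map       = _++ y
  ; injective = λ {x} {x'} eq → ++-injectiveˡ x x' eq
  ; adjacent  = λ {x} {x'} adj →
      trans (distance-++ x x' y y) (cong₂ _+_ adj (distance-self y))
  }

fixLeft : ∀ {a b} → Subset a → CubeEmbedding b (a + b)
fixLeft x = record
  { map       = x ++_
  ; injective = ++-injectiveʳ x x
  ; adjacent  = λ {y} {y'} adj →
      trans (distance-++ x x y y') (cong₂ _+_ (distance-self x) adj)
  }

push : ∀ {j a n} → CubeEmbedding a n → PathEmbedding j a → PathEmbedding j n
push f θ = record
  { vmap      = map f ∘ vmap θ
  ; injective = injective θ ∘ injective f
  ; preserves = adjacent f ∘ preserves θ
  }

image-push : ∀ {j a n} (f : CubeEmbedding a n) (θ : PathEmbedding j a) {x x'} →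
  InImage θ x x' → InImage (push f θ) (map f x) (map f x')
image-push f θ (i , inj₁ (p , q)) = i , inj₁ (cong (map f) p , cong (map f) q)
image-push f θ (i , inj₂ (p , q)) = i , inj₂ (cong (map f) p , cong (map f) q)

image-push⁻¹ : ∀ {j a n} (f : CubeEmbedding a n) (θ : PathEmbedding j a) {u u'} →
  InImage (push f θ) u u' →
  ∃₂ λ x x' → u ≡ map f x × u' ≡ map f x' × InImage θ x x'
image-push⁻¹ f θ (i , inj₁ (p , q)) = _ , _ , sym p , sym q , i , inj₁ (refl , refl)
image-push⁻¹ f θ (i , inj₂ (p , q)) = _ , _ , sym q , sym p , i , inj₂ (refl , refl)

Decomposes : ∀ {j n} {I : Set} → (I → PathEmbedding j n) → Set
Decomposes {n = n} {I} θ =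
  ∀ (x y : Subset n) → QAdj x y →
    Σ I λ i → InImage (θ i) x y × (∀ i' → InImage (θ i') x y → i' ≡ i)

renumber : ∀ {j n} {I J : Set} (e : J ↔ I) (θ : I → PathEmbedding j n) →
  Decomposes θ → Decomposes (θ ∘ Inverse.to e)
renumber e θ dec x y adj with dec x y adj
... | i , im , unique =
  from i , subst (λ k → InImage (θ k) x y) (sym (strictlyInverseˡ i)) im ,
  λ i' im' → trans (sym (strictlyInverseʳ i')) (cong from (unique (to i') im'))
  where open Inverse e

decomposition⇒divides : ∀ {j n r} {I : Set} → Fin r ↔ I →
  (θ : I → PathEmbedding j n) → Decomposes θ → PathDividesCube j n
decomposition⇒divides e θ dec = _ , θ ∘ Inverse.to e , renumber e θ dec

vertices↔ : ∀ n → Fin (2 ^ n) ↔ Subset n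
vertices↔ zero    = mk↔ₛ′ (λ _ → []) (λ _ → fzero) (λ { [] → refl })
                              (λ { fzero → refl ; (fsuc ()) })
vertices↔ (suc n) = ↔-trans *↔× (↔-trans (2↔Bool ×-cong vertices↔ n) cons↔)
  where
  cons↔ : (Bool × Subset n) ↔ Subset (suc n)
  cons↔ = mk↔ₛ′ (λ (b , v) → b ∷ v) (λ { (b ∷ v) → b , v })
                (λ { (b ∷ v) → refl }) (λ { (b , v) → refl })

module Product {j a b r s : ℕ}
  (θ : Fin r → PathEmbedding j a) (φ : Fin s → PathEmbedding j b) where

  Index : Set
  Index = (Fin r × Subset b) ⊎ (Fin s × Subset a)

  product : Index → PathEmbedding j (a + b)
  product (inj₁ (i , y)) = push (fixRight y) (θ i)
  product (inj₂ (l , x)) = push (fixLeft x) (φ l)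

  Index↔ : Fin (r * 2 ^ b + s * 2 ^ a) ↔ Index
  Index↔ = ↔-trans +↔⊎ ( ↔-trans *↔× (↔-refl ×-cong vertices↔ b)
                       ⊎-cong ↔-trans *↔× (↔-refl ×-cong vertices↔ a))

  -- The copies containing an edge of the layer  Q a ++ y : only θ-copies on that
  -- layer qualify, since a φ-copy keeps the left block constant.
  left-edge : Decomposes θ → ∀ x x' y → QAdj x x' →
    Σ Index λ k → InImage (product k) (x ++ y) (x' ++ y) ×
                  (∀ k' → InImage (product k') (x ++ y) (x' ++ y) → k' ≡ k)
  left-edge decθ x x' y adj with decθ x x' adj
  ... | i , im , unique = inj₁ (i , y) , image-push (fixRight y) (θ i) im , only
    where
    only : ∀ k' → InImage (product k') (x ++ y) (x' ++ y) → k' ≡ inj₁ (i , y)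
    only (inj₁ (i' , y')) im' with image-push⁻¹ (fixRight y') (θ i') im'
    ... | w , w' , p , q , imw with ++-injective x w p | ++-injectiveˡ x' w' q
    ... | refl , refl | refl = cong (λ i₀ → inj₁ (i₀ , y)) (unique i' imw)
    only (inj₂ (l , x₀)) im' with image-push⁻¹ (fixLeft x₀) (φ l) im'
    ... | _ , _ , p , q , _ with ++-injectiveˡ x x₀ p | ++-injectiveˡ x' x₀ q
    ... | refl | refl = ⊥-elim (adjacent-irreflexive x adj)

  right-edge : Decomposes φ → ∀ x y y' → QAdj y y' →
    Σ Index λ k → InImage (product k) (x ++ y) (x ++ y') ×
                  (∀ k' → InImage (product k') (x ++ y) (x ++ y') → k' ≡ k)
  right-edge decφ x y y' adj with decφ y y' adj
  ... | l , im , unique = inj₂ (l , x) , image-push (fixLeft x) (φ l) im , only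
    where
    only : ∀ k' → InImage (product k') (x ++ y) (x ++ y') → k' ≡ inj₂ (l , x)
    only (inj₂ (l' , x')) im' with image-push⁻¹ (fixLeft x') (φ l') im'
    ... | w , w' , p , q , imw with ++-injective x x' p | ++-injectiveʳ x x' q
    ... | refl , refl | refl = cong (λ l₀ → inj₂ (l₀ , x)) (unique l' imw)
    only (inj₁ (i , y₀)) im' with image-push⁻¹ (fixRight y₀) (θ i) im'
    ... | w , w' , p , q , _ with ++-injectiveʳ x w p | ++-injectiveʳ x w' q
    ... | refl | refl = ⊥-elim (adjacent-irreflexive y adj)

  product-decomposes : Decomposes θ → Decomposes φ → Decomposes product
  product-decomposes decθ decφ z z' adj with splitAt a z | splitAt a z'
  ... | x , y , refl | x' , y' , refl with adjacent-++ x x' y y' adj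
  ... | inj₁ (adjx , refl) = left-edge decθ x x' y adjx
  ... | inj₂ (refl , adjy) = right-edge decφ x y y' adjy

divides-+ : ∀ {j a b} → PathDividesCube j a → PathDividesCube j b →
  PathDividesCube j (a + b)
divides-+ (_ , θ , decθ) (_ , φ , decφ) =
  decomposition⇒divides Index↔ product (product-decomposes decθ decφ)
  where open Product θ φ

divides-zero : ∀ {j} → PathDividesCube j 0
divides-zero = 0 , (λ ()) , λ { [] [] () }

divides-* : ∀ {j k} q → PathDividesCube j k → PathDividesCube j (q * k)
divides-* zero    _ = divides-zero
divides-* (suc q) D = divides-+ D (divides-* q D)

corollary3 : (j k n : ℕ) → 1 ≤ j → 1 ≤ k → 1 ≤ n →
    k ∣ n → PathDividesCube j k → PathDividesCube j n
corollary3 j k n _ _ _ (divides q refl) = divides-* q
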